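{- Let $U$ and $W$ be non-adjacent vertices in a shortest path graph $\mathcal{H}$. Then exactly one of the following holds: (a) $|N_{\mathcal{H}}(U)\cap N_{\mathcal{H}}(W)|\leq 1$; or (b) $|N_{\mathcal{H}}(U)\cap N_{\mathcal{H}}(W)|=2$ and the two vertices of $N_{\mathcal{H}}(U)\cap N_{\mathcal{H}}(W)$ together with $U$ and $W$ induce a $4$-cycle in $\mathcal{H}$.
   Context: For a simple graph $G$ and distinct $a,b\in V(G)$, the shortest path graph $S(G,a,b)$ has as vertices the shortest $a$–$b$ paths in $G$, two being adjacent iff their vertex sets differ in exactly one vertex. A shortest path graph is any graph isomorphic to some $S(G,a,b)$. $N_{\mathcal{H}}(v)$ denotes the neighborhood of $v$ in $\mathcal{H}$. -}

module Defs where

open import Level using (0ℓ)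
open import Data.Nat using (ℕ; _≤_)
open import Data.Fin using (Fin)
open import Data.List using (List; []; _∷_; length)
open import Data.List.Membership.Propositional using (_∈_; _∉_)
open import Data.List.Relation.Unary.Unique.Propositional using (Unique)
open import Data.List.Relation.Binary.Permutation.Propositional using (_↭_)
open import Data.Product using (Σ; ∃; _×_; _,_)
open import Data.Sum using (_⊎_)
open import Relation.Binary.PropositionalEquality using (_≡_; _≢_)
open import Relation.Nullary using (¬_)

record Graph (n : ℕ) : Set₁ where
  field
    Adj   : Fin n → Fin n → Set
    sym   : ∀ {x y} → Adj x y → Adj y x
    irrefl : ∀ {x} → ¬ Adj x x
open Graph public

module _ {n : ℕ} (G : Graph n) where

  data Walk : Fin n → Fin n → List (Fin n) → Set where
    stop : ∀ a → Walk a a (a ∷ [])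
    step : ∀ {a c b xs} → Adj G a c → Walk c b xs → Walk a b (a ∷ xs)

  IsPath : Fin n → Fin n → List (Fin n) → Set
  IsPath a b xs = Walk a b xs × Unique xs

  IsShortestPath : Fin n → Fin n → List (Fin n) → Set
  IsShortestPath a b xs =
    IsPath a b xs × (∀ ys → IsPath a b ys → length xs ≤ length ys)

DifferInOne : {A : Set} → List A → List A → Set
DifferInOne {A} P Q =
  Σ A λ x → Σ A λ y →
    x ∈ P × x ∉ Q × y ∈ Q × y ∉ P ×
    (∀ z → z ∈ P → z ∉ Q → z ≡ x) ×
    (∀ z → z ∈ Q → z ∉ P → z ≡ y)

record IsoToSPG {m n : ℕ} (H : Graph m) (G : Graph n) (a b : Fin n) : Set where
  field
    φ          : Fin m → List (Fin n)
    φ-shortest : ∀ i → IsShortestPath G a b (φ i)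
    φ-injective : ∀ i j → φ i ≡ φ j → i ≡ j
    φ-surjective : ∀ P → IsShortestPath G a b P → ∃ λ i → φ i ≡ P
    φ-adj      : ∀ i j → Adj H i j → DifferInOne (φ i) (φ j)
    φ-adj⁻¹    : ∀ i j → DifferInOne (φ i) (φ j) → Adj H i j

IsShortestPathGraph : {m : ℕ} → Graph m → Set₁
IsShortestPathGraph H =
  Σ ℕ λ n → Σ (Graph n) λ G → Σ (Fin n) λ a → Σ (Fin n) λ b →
    a ≢ b × IsoToSPG H G a b

module _ {m : ℕ} (H : Graph m) where

  CommonNbr : Fin m → Fin m → Fin m → Set
  CommonNbr U W X = Adj H U X × Adj H W X

  CommonNbrsAtMostOne : Fin m → Fin m → Set
  CommonNbrsAtMostOne U W =
    ∀ X Y → CommonNbr U W X → CommonNbr U W Y → X ≡ Y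

  IsInducedC4 : Fin m → Fin m → Fin m → Fin m → Set
  IsInducedC4 y1 y2 y3 y4 =
    Unique (y1 ∷ y2 ∷ y3 ∷ y4 ∷ []) ×
    Adj H y1 y2 × Adj H y2 y3 × Adj H y3 y4 × Adj H y4 y1 ×
    ¬ Adj H y1 y3 × ¬ Adj H y2 y4

  InducesC4 : Fin m → Fin m → Fin m → Fin m → Set
  InducesC4 v1 v2 v3 v4 =
    Σ (Fin m) λ y1 → Σ (Fin m) λ y2 → Σ (Fin m) λ y3 → Σ (Fin m) λ y4 →
      (y1 ∷ y2 ∷ y3 ∷ y4 ∷ []) ↭ (v1 ∷ v2 ∷ v3 ∷ v4 ∷ []) ×
      IsInducedC4 y1 y2 y3 y4

  CommonNbrsTwoC4 : Fin m → Fin m → Set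
  CommonNbrsTwoC4 U W =
    Σ (Fin m) λ X → Σ (Fin m) λ Y →
      X ≢ Y × CommonNbr U W X × CommonNbr U W Y ×
      (∀ Z → CommonNbr U W Z → Z ≡ X ⊎ Z ≡ Y) ×
      InducesC4 U X W Y

module Submission where

-- All shortest a–b paths of G have the same length, and a vertex
-- lying on a shortest a–b path always sits at the same position (its distance
-- from a).  So a shortest path is faithfully described by its position sequence
-- k ↦ (k-th vertex), and two shortest paths differ in exactly one vertex iff
-- their sequences differ at exactly one position.  A shortest path graph H is
-- thus an induced subgraph of a Hamming-type graph on sequences ℕ → Maybe (Fin n).
-- In such a graph, a common neighbour X of two distinct non-adjacent sequences
-- U, W shows that U and W differ at exactly two positions i ≠ j, and X is one of
-- the two "mixtures" of U and W at these positions.  Hence there are at most two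
-- common neighbours, and two distinct ones differ at both positions, so they are
-- non-adjacent: U, X, W, Y is an induced 4-cycle.

open import Defs hiding (sym)
open import Data.Nat using (ℕ; zero; suc; _≤_; s≤s; pred) renaming (_≟_ to _≟ℕ_)
open import Data.Nat.Properties using (≤-antisym; ≤-trans; ≤-refl; m≤n⇒m≤1+n; +-cancelʳ-≤)
open import Data.Fin using (Fin)
open import Data.Fin.Properties using (any?; all?) renaming (_≟_ to _≟F_)
open import Data.Maybe using (Maybe; just; nothing)
open import Data.Maybe.Properties using (just-injective)
open import Data.List using (List; []; _∷_; length; _++_; [_])
open import Data.List.Properties using (length-++)
open import Data.List.Membership.Propositional using (_∈_; _∉_)
open import Data.List.Relation.Unary.Any using (here; there)
open import Data.List.Relation.Unary.All using ([]; _∷_)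
open import Data.List.Relation.Unary.All.Properties.Core using (¬Any⇒All¬)
open import Data.List.Relation.Unary.AllPairs using ([]; _∷_)
open import Data.List.Relation.Unary.Unique.Propositional using (Unique)
open import Data.List.Relation.Binary.Permutation.Propositional using (↭-refl)
open import Data.Product using (Σ; ∃; _×_; _,_; proj₁; proj₂)
open import Data.Sum using (_⊎_; inj₁; inj₂)
open import Data.Empty using (⊥-elim)
open import Relation.Binary.Definitions using (Decidable)
open import Relation.Binary.PropositionalEquality
  using (_≡_; _≢_; _≗_; refl; sym; trans; cong; cong₂; subst; subst₂; ≢-sym)
open import Relation.Nullary using (¬_; Dec; yes; no)
open import Relation.Nullary.Decidable using (_×-dec_; _→-dec_; ¬?; map′)

at : {A : Set} → List A → ℕ → Maybe A
at []       k       = nothing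
at (x ∷ xs) zero    = just x
at (x ∷ xs) (suc k) = at xs k

at-injective : {A : Set} (xs ys : List A) → at xs ≗ at ys → xs ≡ ys
at-injective []       []       h = refl
at-injective []       (y ∷ ys) h with h zero
... | ()
at-injective (x ∷ xs) []       h with h zero
... | ()
at-injective (x ∷ xs) (y ∷ ys) h =
  cong₂ _∷_ (just-injective (h zero)) (at-injective xs ys (λ k → h (suc k)))

∈⇒at : {A : Set} {v : A} {xs : List A} → v ∈ xs → ∃ λ k → at xs k ≡ just v
∈⇒at (here refl) = zero , refl
∈⇒at (there v∈xs) with ∈⇒at v∈xs
... | k , e = suc k , e

at⇒∈ : {A : Set} {v : A} (xs : List A) (k : ℕ) → at xs k ≡ just v → v ∈ xs
at⇒∈ (x ∷ xs) zero    refl = here refl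
at⇒∈ (x ∷ xs) (suc k) e    = there (at⇒∈ xs k e)

at-split : {A : Set} {v : A} (xs : List A) (k : ℕ) → at xs k ≡ just v →
  Σ (List A) λ ys → Σ (List A) λ zs → xs ≡ ys ++ v ∷ zs × length ys ≡ k
at-split (x ∷ xs) zero    refl = [] , xs , refl , refl
at-split (x ∷ xs) (suc k) e with at-split xs k e
... | ys , zs , refl , refl = x ∷ ys , zs , refl , refl

at-nothing-transfer : {A : Set} (xs ys : List A) (k : ℕ) → length xs ≡ length ys →
  at xs k ≡ nothing → at ys k ≡ nothing
at-nothing-transfer []       []       k       _ _ = refl
at-nothing-transfer (x ∷ xs) (y ∷ ys) (suc k) l e =
  at-nothing-transfer xs ys k (cong pred l) e

module Walks {n : ℕ} (G : Graph n) where
  open import Data.List.Membership.DecPropositional (_≟F_ {n}) using (_∈?_)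

  walk-split : ∀ {a b v} (ys : List (Fin n)) {zs} → Walk G a b (ys ++ v ∷ zs) →
    Walk G a v (ys ++ [ v ]) × Walk G v b (v ∷ zs)
  walk-split []            (stop _)   = stop _ , stop _
  walk-split []            (step e w) = stop _ , step e w
  walk-split (_ ∷ [])      (step e w) with walk-split [] w
  ... | w₁ , w₂ = step e w₁ , w₂
  walk-split (_ ∷ y ∷ ys)  (step e w) with walk-split (y ∷ ys) w
  ... | w₁ , w₂ = step e w₁ , w₂

  walk-join : ∀ {a v b} (ys : List (Fin n)) {zs} → Walk G a v (ys ++ [ v ]) →
    Walk G v b (v ∷ zs) → Walk G a b (ys ++ v ∷ zs)
  walk-join []           (stop _)     w₂ = w₂
  walk-join []           (step _ ())  w₂
  walk-join (_ ∷ [])     (step e w₁)  w₂ = step e (walk-join [] w₁ w₂)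
  walk-join (_ ∷ y ∷ ys) (step e w₁)  w₂ = step e (walk-join (y ∷ ys) w₁ w₂)

  path-suffix : ∀ {a c b} (ys : List (Fin n)) → a ∈ ys → Walk G c b ys → Unique ys →
    Σ (List (Fin n)) λ zs → IsPath G a b zs × length zs ≤ length ys
  path-suffix _        (here refl)  (stop _)   u       = _ , (stop _ , u) , ≤-refl
  path-suffix _        (here refl)  (step e w) u       = _ , (step e w , u) , ≤-refl
  path-suffix (_ ∷ ys) (there a∈ys) (step _ w) (_ ∷ u) with path-suffix ys a∈ys w u
  ... | zs , p , le = zs , p , m≤n⇒m≤1+n le

  walk⇒path : ∀ {a b xs} → Walk G a b xs →
    Σ (List (Fin n)) λ ys → IsPath G a b ys × length ys ≤ length xs
  walk⇒path (stop a) = a ∷ [] , (stop a , [] ∷ []) , ≤-refl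
  walk⇒path {a} (step a~c w) with walk⇒path w
  ... | ys , (pw , u) , le with a ∈? ys
  ...   | no a∉ys = a ∷ ys , (step a~c pw , ¬Any⇒All¬ ys a∉ys ∷ u) , s≤s le
  ...   | yes a∈ys with path-suffix ys a∈ys pw u
  ...     | zs , p , le′ = zs , p , m≤n⇒m≤1+n (≤-trans le′ le)

  module ShortestPaths (a b : Fin n) where

    shortest≤walk : ∀ {P xs} → IsShortestPath G a b P → Walk G a b xs → length P ≤ length xs
    shortest≤walk (_ , minimal) w with walk⇒path w
    ... | ys , p , le = ≤-trans (minimal ys p) le

    shortest-length : ∀ {P Q} → IsShortestPath G a b P → IsShortestPath G a b Q →
      length P ≡ length Q
    shortest-length sP sQ = ≤-antisym (proj₂ sP _ (proj₁ sQ)) (proj₂ sQ _ (proj₁ sP))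

    -- If v lies on shortest paths P and Q, then replacing Q's part before v by
    -- P's part gives an a–b walk; minimality of Q bounds Q's prefix by P's.
    prefix-length-≤ : ∀ {v} ys zs ys′ zs′ →
      IsShortestPath G a b (ys ++ v ∷ zs) → IsShortestPath G a b (ys′ ++ v ∷ zs′) →
      length ys′ ≤ length ys
    prefix-length-≤ {v} ys zs ys′ zs′ sP sQ =
      +-cancelʳ-≤ (suc (length zs′)) (length ys′) (length ys)
        (subst₂ _≤_ (length-++ ys′) (length-++ ys) (shortest≤walk sQ mixed))
      where
        mixed : Walk G a b (ys ++ v ∷ zs′)
        mixed = walk-join ys (proj₁ (walk-split ys (proj₁ (proj₁ sP))))
                             (proj₂ (walk-split ys′ (proj₁ (proj₁ sQ))))

    position-unique : ∀ {P Q v} i j → IsShortestPath G a b P → IsShortestPath G a b Q →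
      at P i ≡ just v → at Q j ≡ just v → i ≡ j
    position-unique {P} {Q} i j sP sQ eP eQ with at-split P i eP | at-split Q j eQ
    ... | ys , zs , refl , refl | ys′ , zs′ , refl , refl =
      ≤-antisym (prefix-length-≤ ys′ zs′ ys zs sQ sP) (prefix-length-≤ ys zs ys′ zs′ sP sQ)

module Hamming {A : Set} where

  OneApart : (ℕ → A) → (ℕ → A) → Set
  OneApart u v = Σ ℕ λ i → u i ≢ v i × (∀ k → k ≢ i → u k ≡ v k)

  -- This is the shape of every common
  -- neighbour of two sequences at distance two.
  record Between (u w x : ℕ → A) : Set where
    field
      i j     : ℕ
      i≢j     : i ≢ j
      u-i     : u i ≢ w i
      u-j     : u j ≢ w j
      agree   : ∀ k → k ≢ i → k ≢ j → u k ≡ w k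
      x-at-i  : x i ≡ w i
      x-off-i : ∀ k → k ≢ i → x k ≡ u k

  -- A common neighbour of distinct, non-adjacent u and w is between them.
  -- (Were both changes at the same position, u and w would be equal or adjacent.)
  between : ∀ {u w x} → OneApart u x → OneApart x w → ¬ OneApart u w → ¬ u ≗ w →
    Between u w x
  between {u} {w} {x} (i , ux-i , ux-agree) (j , xw-j , xw-agree) ¬uw u≢w = record
    { i = i ; j = j ; i≢j = i≢j
    ; u-i = λ e → ux-i (trans e (sym x-at-i))
    ; u-j = λ e → xw-j (trans (sym (ux-agree j (≢-sym i≢j))) e)
    ; agree = agree
    ; x-at-i = x-at-i
    ; x-off-i = λ k k≢i → sym (ux-agree k k≢i) }
    where
      agree : ∀ k → k ≢ i → k ≢ j → u k ≡ w k
      agree k k≢i k≢j = trans (ux-agree k k≢i) (xw-agree k k≢j)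
      i≢j : i ≢ j
      i≢j refl = ¬uw (i , (λ e → u≢w (everywhere e)) , λ k k≢i → agree k k≢i k≢i)
        where
          everywhere : u i ≡ w i → u ≗ w
          everywhere e k with k ≟ℕ i
          ... | yes refl = e
          ... | no k≢i   = agree k k≢i k≢i
      x-at-i : x i ≡ w i
      x-at-i = xw-agree i i≢j

  module _ {u w : ℕ → A} where
    open Between

    differ⇒i-or-j : ∀ {x} (B : Between u w x) k → u k ≢ w k → k ≡ i B ⊎ k ≡ j B
    differ⇒i-or-j B k ne with k ≟ℕ i B | k ≟ℕ j B
    ... | yes e   | _       = inj₁ e
    ... | no _    | yes e   = inj₂ e
    ... | no k≢i  | no k≢j  = ⊥-elim (ne (agree B k k≢i k≢j))

    between-determined : ∀ {x y} (B : Between u w x) (C : Between u w y) → i C ≡ i B → x ≗ y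
    between-determined {x} {y} B C e k with k ≟ℕ i B
    ... | yes k≡iB = trans (subst (λ l → x l ≡ w l) (sym k≡iB) (x-at-i B))
                           (sym (subst (λ l → y l ≡ w l) (trans e (sym k≡iB)) (x-at-i C)))
    ... | no k≢i   = trans (x-off-i B k k≢i) (sym (x-off-i C k (λ k≡iC → k≢i (trans k≡iC e))))

    between-swap : ∀ {x y} (B : Between u w x) (C : Between u w y) → ¬ x ≗ y →
      i C ≡ j B × j C ≡ i B
    between-swap B C x≢y with differ⇒i-or-j B (i C) (u-i C)
    ... | inj₁ e = ⊥-elim (x≢y (between-determined B C e))
    ... | inj₂ e with differ⇒i-or-j B (j C) (u-j C)
    ...   | inj₁ e′ = e , e′
    ...   | inj₂ e′ = ⊥-elim (i≢j C (trans e (sym e′)))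

    between-third : ∀ {x y z} (B : Between u w x) (C : Between u w y) (D : Between u w z) →
      ¬ x ≗ y → z ≗ x ⊎ z ≗ y
    between-third B C D x≢y with differ⇒i-or-j B (i D) (u-i D)
    ... | inj₁ e = inj₁ (λ k → sym (between-determined B D e k))
    ... | inj₂ e = inj₂ (λ k → sym (between-determined C D (trans e (sym (proj₁ (between-swap B C x≢y)))) k))

    -- Two different mixtures differ at both positions i and j, so are not adjacent.
    between-nonadjacent : ∀ {x y} (B : Between u w x) (C : Between u w y) → ¬ x ≗ y →
      ¬ OneApart x y
    between-nonadjacent {x} {y} B C x≢y (t , _ , xy-agree) =
      i≢j B (trans (only-t (i B) differ-at-i) (sym (only-t (j B) differ-at-j)))
      where
        swapped = between-swap B C x≢y
        only-t : ∀ k → x k ≢ y k → k ≡ t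
        only-t k ne with k ≟ℕ t
        ... | yes e   = e
        ... | no k≢t  = ⊥-elim (ne (xy-agree k k≢t))
        y-at-iB : y (i B) ≡ u (i B)
        y-at-iB = x-off-i C (i B) (λ e → i≢j B (trans e (proj₁ swapped)))
        y-at-jB : y (j B) ≡ w (j B)
        y-at-jB = subst (λ k → y k ≡ w k) (proj₁ swapped) (x-at-i C)
        differ-at-i : x (i B) ≢ y (i B)
        differ-at-i e = u-i B (sym (trans (sym (x-at-i B)) (trans e y-at-iB)))
        differ-at-j : x (j B) ≢ y (j B)
        differ-at-j e = u-j B (trans (sym (x-off-i B (j B) (≢-sym (i≢j B)))) (trans e y-at-jB))

module PathSequences {n : ℕ} (G : Graph n) (a b : Fin n) where
  open Walks.ShortestPaths G a b
  open Hamming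
  open import Data.List.Membership.DecPropositional (_≟F_ {n}) using (_∈?_)

  private
    SP : List (Fin n) → Set
    SP = IsShortestPath G a b

  shared-same-position : ∀ {P Q z} k → SP P → SP Q → at P k ≡ just z → z ∈ Q → at Q k ≡ just z
  shared-same-position {Q = Q} k sP sQ eP z∈Q with ∈⇒at z∈Q
  ... | j , eQ with position-unique k j sP sQ eP eQ
  ... | refl = eQ

  differ⇒∉ : ∀ {P Q x} k → SP P → SP Q → at P k ≢ at Q k → at P k ≡ just x → x ∉ Q
  differ⇒∉ k sP sQ ne eP x∈Q = ne (trans eP (sym (shared-same-position k sP sQ eP x∈Q)))

  unique-outsider : ∀ {P Q x} i → SP P → SP Q → (∀ k → k ≢ i → at P k ≡ at Q k) →
    at P i ≡ just x → ∀ z → z ∈ P → z ∉ Q → z ≡ x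
  unique-outsider {P} {Q} i sP sQ agree eP z z∈P z∉Q with ∈⇒at z∈P
  ... | k , ez with k ≟ℕ i
  ... | yes refl = just-injective (trans (sym ez) eP)
  ... | no k≢i   = ⊥-elim (z∉Q (at⇒∈ Q k (trans (sym (agree k k≢i)) ez)))

  differInOne⇒oneApart : ∀ {P Q} → SP P → SP Q → DifferInOne P Q → OneApart (at P) (at Q)
  differInOne⇒oneApart {P} {Q} sP sQ (x , _ , x∈P , x∉Q , _ , _ , outsiderP , _)
    with ∈⇒at x∈P
  ... | i , ex = i , (λ e → x∉Q (at⇒∈ Q i (trans (sym e) ex))) , agree
    where
      agree : ∀ k → k ≢ i → at P k ≡ at Q k
      agree k k≢i with at P k in eP
      ... | nothing = sym (at-nothing-transfer P Q k (shortest-length sP sQ) eP)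
      ... | just z with z ∈? Q
      ...   | yes z∈Q = sym (shared-same-position k sP sQ eP z∈Q)
      ...   | no z∉Q  = ⊥-elim (k≢i (position-unique k i sP sP
                                      (trans eP (cong just (outsiderP z (at⇒∈ P k eP) z∉Q))) ex))

  oneApart⇒differInOne : ∀ {P Q} → SP P → SP Q → OneApart (at P) (at Q) → DifferInOne P Q
  oneApart⇒differInOne {P} {Q} sP sQ (i , ne , agree) with at P i in ex | at Q i in ey
  ... | nothing | _ = ⊥-elim (ne (trans (sym (at-nothing-transfer P Q i (shortest-length sP sQ) ex)) ey))
  ... | just x | just y =
    x , y , at⇒∈ P i ex , differ⇒∉ i sP sQ (subst₂ _≢_ (sym ex) (sym ey) ne) ex ,
    at⇒∈ Q i ey , differ⇒∉ i sQ sP (subst₂ _≢_ (sym ey) (sym ex) (≢-sym ne)) ey ,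
    unique-outsider i sP sQ agree ex ,
    unique-outsider i sQ sP (λ k k≢i → sym (agree k k≢i)) ey
  ... | just x | nothing with trans (sym ex) (at-nothing-transfer Q P i (shortest-length sQ sP) ey)
  ...   | ()

-- DifferInOne is decidable, as all quantifiers range over Fin n.
differInOne? : {n : ℕ} (P Q : List (Fin n)) → Dec (DifferInOne P Q)
differInOne? {n} P Q =
  any? λ x → any? λ y →
    (x ∈? P) ×-dec ¬? (x ∈? Q) ×-dec (y ∈? Q) ×-dec ¬? (y ∈? P) ×-dec
    all? (λ z → (z ∈? P) →-dec ¬? (z ∈? Q) →-dec (z ≟F x)) ×-dec
    all? (λ z → (z ∈? Q) →-dec ¬? (z ∈? P) →-dec (z ≟F y))
  where open import Data.List.Membership.DecPropositional (_≟F_ {n}) using (_∈?_)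

module CommonNeighbours {m : ℕ} (H : Graph m) where

  adj⇒≢ : ∀ {p q} → Adj H p q → p ≢ q
  adj⇒≢ p~q refl = irrefl H p~q

  CommonPair : Fin m → Fin m → Set
  CommonPair U W = Σ (Fin m) λ X → Σ (Fin m) λ Y → X ≢ Y × CommonNbr H U W X × CommonNbr H U W Y

  commonPair? : Decidable (Adj H) → ∀ U W → Dec (CommonPair U W)
  commonPair? adj? U W = any? λ X → any? λ Y →
    ¬? (X ≟F Y) ×-dec (adj? U X ×-dec adj? W X) ×-dec (adj? U Y ×-dec adj? W Y)

  noPair⇒atMostOne : ∀ {U W} → ¬ CommonPair U W → CommonNbrsAtMostOne H U W
  noPair⇒atMostOne noPair X Y cX cY with X ≟F Y
  ... | yes X≡Y = X≡Y
  ... | no X≢Y  = ⊥-elim (noPair (X , Y , X≢Y , cX , cY))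

  commonPair⇒C4 : ∀ {U W X Y} → U ≢ W → ¬ Adj H U W → X ≢ Y → ¬ Adj H X Y →
    CommonNbr H U W X → CommonNbr H U W Y → InducesC4 H U X W Y
  commonPair⇒C4 {U} {W} {X} {Y} U≢W ¬UW X≢Y ¬XY (U~X , W~X) (U~Y , W~Y) =
    U , X , W , Y , ↭-refl , distinct , U~X , Graph.sym H W~X , W~Y , Graph.sym H U~Y , ¬UW , ¬XY
    where
      distinct : Unique (U ∷ X ∷ W ∷ Y ∷ [])
      distinct = (adj⇒≢ U~X ∷ U≢W ∷ adj⇒≢ U~Y ∷ [])
               ∷ (≢-sym (adj⇒≢ W~X) ∷ X≢Y ∷ [])
               ∷ (adj⇒≢ W~Y ∷ [])
               ∷ [] ∷ []

  atMostOne-excludes-twoC4 : ∀ {U W} → ¬ (CommonNbrsAtMostOne H U W × CommonNbrsTwoC4 H U W)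
  atMostOne-excludes-twoC4 (atMostOne , X , Y , X≢Y , cX , cY , _) = X≢Y (atMostOne X Y cX cY)

module SequenceModel {m n : ℕ} {H : Graph m} {G : Graph n} {a b : Fin n}
                     (iso : IsoToSPG H G a b) where
  open IsoToSPG iso
  open PathSequences G a b
  open Hamming

  seq : Fin m → ℕ → Maybe (Fin n)
  seq i = at (φ i)

  adj⇒oneApart : ∀ {i j} → Adj H i j → OneApart (seq i) (seq j)
  adj⇒oneApart {i} {j} i~j = differInOne⇒oneApart (φ-shortest i) (φ-shortest j) (φ-adj i j i~j)

  oneApart⇒adj : ∀ {i j} → OneApart (seq i) (seq j) → Adj H i j
  oneApart⇒adj {i} {j} d = φ-adj⁻¹ i j (oneApart⇒differInOne (φ-shortest i) (φ-shortest j) d)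

  seq-injective : ∀ {i j} → seq i ≗ seq j → i ≡ j
  seq-injective {i} {j} h = φ-injective i j (at-injective (φ i) (φ j) h)

  adj? : Decidable (Adj H)
  adj? i j = map′ (φ-adj⁻¹ i j) (φ-adj i j) (differInOne? (φ i) (φ j))

  module _ {U W : Fin m} (U≢W : U ≢ W) (¬UW : ¬ Adj H U W) where

    common⇒between : ∀ {X} → CommonNbr H U W X → Between (seq U) (seq W) (seq X)
    common⇒between (U~X , W~X) =
      between (adj⇒oneApart U~X) (adj⇒oneApart (Graph.sym H W~X))
              (λ d → ¬UW (oneApart⇒adj d)) (λ h → U≢W (seq-injective h))

    only-two-common : ∀ {X Y} → X ≢ Y → CommonNbr H U W X → CommonNbr H U W Y →
      ∀ Z → CommonNbr H U W Z → Z ≡ X ⊎ Z ≡ Y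
    only-two-common X≢Y cX cY Z cZ
      with between-third (common⇒between cX) (common⇒between cY) (common⇒between cZ)
                         (λ h → X≢Y (seq-injective h))
    ... | inj₁ h = inj₁ (seq-injective h)
    ... | inj₂ h = inj₂ (seq-injective h)

    common-nonadjacent : ∀ {X Y} → X ≢ Y → CommonNbr H U W X → CommonNbr H U W Y → ¬ Adj H X Y
    common-nonadjacent X≢Y cX cY X~Y =
      between-nonadjacent (common⇒between cX) (common⇒between cY)
                          (λ h → X≢Y (seq-injective h)) (adj⇒oneApart X~Y)

proposition13 : {m : ℕ} (H : Graph m) → IsShortestPathGraph H →
    (U W : Fin m) → U ≢ W → ¬ Adj H U W →
    (CommonNbrsAtMostOne H U W ⊎ CommonNbrsTwoC4 H U W) ×
    ¬ (CommonNbrsAtMostOne H U W × CommonNbrsTwoC4 H U W)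
proposition13 H (_ , _ , _ , _ , _ , iso) U W U≢W ¬UW = dichotomy , atMostOne-excludes-twoC4
  where
    open CommonNeighbours H
    open SequenceModel iso
    dichotomy : CommonNbrsAtMostOne H U W ⊎ CommonNbrsTwoC4 H U W
    dichotomy with commonPair? adj? U W
    ... | no noPair = inj₁ (noPair⇒atMostOne noPair)
    ... | yes (X , Y , X≢Y , cX , cY) =
      inj₂ (X , Y , X≢Y , cX , cY , only-two-common U≢W ¬UW X≢Y cX cY ,
            commonPair⇒C4 U≢W ¬UW X≢Y (common-nonadjacent U≢W ¬UW X≢Y cX cY) cX cY)
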